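{- Let $f\in\Theta_{k,n}$, $\delta=(k,n)$, $\alpha\in[k-1]\times[n-1]$ and $Q_\infty=P_\infty+\alpha$. (a) If $\operatorname{slope}(\alpha)\le\operatorname{slope}(\delta)$, then some integer point of $Q_\infty$ is below $P_\infty$. (b) If $\operatorname{slope}(\alpha)\ge\operatorname{slope}(\delta)$, then some integer point of $Q_\infty$ is above $P_\infty$. (c) If $\operatorname{slope}(\alpha)=\operatorname{slope}(\delta)$, then $\alpha\in{\operatorname{F}}'(f)$.
   Context: $\Theta_{k,n}$ ($1\le k\le n-1$) is the set of bijections $f:\mathbb{Z}\to\mathbb{Z}$ with $f(i+n)=f(i)+n$, $i<f(i)<i+n$, $\sum_{i=1}^n(f(i)-i)=kn$, and induced permutation of $\mathbb{Z}/n\mathbb{Z}$ an $n$-cycle. For $\alpha=(a,b)$ put $\operatorname{slope}(\alpha)=a/b$. Points of $\mathbb{R}^2$ are written $(x_1,x_2)$, with $x_1$ the vertical and $x_2$ the horizontal coordinate. Let $p_r=(f^r(0)/n,\,r)$ for $r\in\mathbb{Z}$. $P_\infty$ is the union of the segments $[p_r,p_{r+1}]$; it is the graph (over the horizontal axis) of a continuous function $\psi$. A point $x$ is above (below) $P_\infty$ if $x_1>\psi(x_2)$ (resp. $x_1<\psi(x_2)$). The integer points of $Q_\infty=P_\infty+\alpha$ are the points $p_r+\alpha$. ${\operatorname{F}}'(f)$: for an inversion $(i,j)$ of $f$ ($i<j$, $f(i)>f(j)$, $i\in[n]$), let $f^{(i,j)}$ swap the values $f(i+rn)$ and $f(j+rn)$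 for all $r$. Let $A$ be the residue set of the cycle of $\bar f^{(i,j)}$ containing $i\bmod n$, and $k_1$ the number of elements $a\in A$ (represented in $[n]$) with $\bar f^{(i,j)}(a)<a$ in the induced order on $A$. The point $(k_1,|A|)$ is recorded once per inversion. ${\operatorname{F}}'(f)$ is the resulting multiset; equivalently, $(k_1,|A|)=(k(g),n(g))$ for the standardization $g\in\Theta_{k_1,|A|}$ of that cycle. -}

module Defs where

open import Data.Nat as ℕ using (ℕ; zero; suc)
open import Data.Integer as ℤ using (ℤ; +_; -[1+_])
open import Data.Rational as ℚ using (ℚ)
open import Data.Bool using (Bool; if_then_else_)
open import Data.List using (List; length; filter; upTo)
open import Data.Product using (Σ; ∃; ∃-syntax; _×_; _,_)
open import Relation.Binary.PropositionalEquality using (_≡_)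
open import Relation.Nullary using (¬_; does)

-- representative in [1,n] of the residue class of x modulo n
-- (for n = 0 the value is irrelevant; it never occurs since n ≥ 2)
rep : ℕ → ℤ → ℤ
rep zero    x = x
rep (suc m) x = + suc ((x ℤ.- + 1) ℤ.%ℕ suc m)

-- x / n as a rational (n = 0 never occurs)
divN : ℤ → ℕ → ℚ
divN x zero    = ℚ.0ℚ
divN x (suc m) = x ℚ./ suc m

sumTo : ℕ → (ℤ → ℤ) → ℤ
sumTo zero    h = + 0
sumTo (suc m) h = sumTo m h ℤ.+ h (+ suc m)

iterℕ : ℕ → (ℤ → ℤ) → ℤ → ℤ
iterℕ zero    g x = x
iterℕ (suc m) g x = g (iterℕ m g x)

record IsTheta (k n : ℕ) (f : ℤ → ℤ) : Set where
  field
    k-pos     : 1 ℕ.≤ k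
    k<n       : k ℕ.< n
    finv      : ℤ → ℤ
    finv-f    : ∀ x → finv (f x) ≡ x
    f-finv    : ∀ x → f (finv x) ≡ x
    periodic  : ∀ i → f (i ℤ.+ + n) ≡ f i ℤ.+ + n
    lower     : ∀ i → i ℤ.< f i
    upper     : ∀ i → f i ℤ.< i ℤ.+ + n
    sum-cond  : sumTo n (λ i → f i ℤ.- i) ≡ + (k ℕ.* n)
    -- the induced permutation of ℤ/nℤ is an n-cycle:
    -- the orbit of the class of 1 has n elements
    n-cycle   : ∀ m → 0 ℕ.< m → m ℕ.< n → ¬ (rep n (iterℕ m f (+ 1)) ≡ rep n (+ 1))

iterZ : ∀ {k n f} → IsTheta k n f → ℤ → ℤ → ℤ
iterZ {f = f} θ (+ m)      x = iterℕ m f x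
iterZ         θ -[1+ m ]   x = iterℕ (suc m) (IsTheta.finv θ) x

-- vertical coordinate of p_r = (f^r(0)/n , r)
pv : ∀ {k n f} → IsTheta k n f → ℤ → ℚ
pv {n = n} θ r = divN (iterZ θ r (+ 0)) n

-- ψ : piecewise linear interpolation of the points p_r over the
-- horizontal axis: on [r, r+1], ψ(x₂) = (1-t) pv r + t pv (r+1), t = x₂ - r
ψ : ∀ {k n f} → IsTheta k n f → ℚ → ℚ
ψ θ x₂ = (ℚ.1ℚ ℚ.- t) ℚ.* pv θ r ℚ.+ t ℚ.* pv θ (r ℤ.+ + 1)
  where
    r = ℚ.floor x₂
    t = x₂ ℚ.- (r ℚ./ 1)

-- a point x = (x₁ , x₂) (x₁ vertical, x₂ horizontal)
Above : ∀ {k n f} → IsTheta k n f → ℚ × ℚ → Set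
Above θ (x₁ , x₂) = ψ θ x₂ ℚ.< x₁

Below : ∀ {k n f} → IsTheta k n f → ℚ × ℚ → Set
Below θ (x₁ , x₂) = x₁ ℚ.< ψ θ x₂

-- the integer point p_r + α of Q_∞ = P_∞ + α, α = (a , b)
qpt : ∀ {k n f} → IsTheta k n f → ℕ → ℕ → ℤ → ℚ × ℚ
qpt θ a b r = (pv θ r ℚ.+ (+ a ℚ./ 1) , (r ℤ.+ + b) ℚ./ 1)

slope : ℕ → ℕ → ℚ
slope a b = divN (+ a) b

-- f^{(i,j)}: swaps the values f(i + rn) and f(j + rn) for all r
swapVals : ℕ → (ℤ → ℤ) → ℤ → ℤ → ℤ → ℤ
swapVals n f i j x =
  if does (rep n x ℤ.≟ rep n i) then f (x ℤ.+ (j ℤ.- i))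
  else if does (rep n x ℤ.≟ rep n j) then f (x ℤ.- (j ℤ.- i))
  else f x

-- (a , b) ∈ F'(f): there is an inversion (i , j) of f with i ∈ [n] such that
-- the cycle A of the induced permutation of f^{(i,j)} containing i mod n has
-- |A| = b elements, and a of its elements c (represented in [n]) satisfy
-- (induced image of c) < c.
InF' : (n : ℕ) → (ℤ → ℤ) → ℕ → ℕ → Set
InF' n f a b =
  ∃[ i ] ∃[ j ]
    ( + 1 ℤ.≤ i × i ℤ.≤ + n × i ℤ.< j × f j ℤ.< f i
    × let g̅ : ℤ → ℤ
          g̅ x = rep n (swapVals n f i j x)
          orb : ℕ → ℤ
          orb m = iterℕ m g̅ i
      in ( 1 ℕ.≤ b
         × orb b ≡ i
         × (∀ m → 0 ℕ.< m → m ℕ.< b → ¬ (orb m ≡ i))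
         × a ≡ length (filter (λ m → g̅ (orb m) ℤ.<? orb m) (upTo b)) ) )

module Submission where

-- Let F s = f^s(0) and D s = F (s + b) − (F s + a n), so that p_s + α lies below P_∞ at the
-- integer abscissa s + b iff D s > 0, and above it iff D s < 0. As f induces an n-cycle and
-- Σ (f i − i) = k n, the orbit of any x satisfies f^n(x) = x + k n; hence D is n-periodic,
-- Σ_{s<n} D s = n (k b − a n), and D never vanishes since f^b(x) ≢ x mod n for 0 < b < n.
-- Comparing slopes thus yields (a) and (b). For (c), D changes sign at some t, which makes
-- y = F (t + b) < x = F t + a n an inversion of f. After swapping the values of f on the classes
-- of y and x, the cycle through y mod n runs through the classes of F (t + 1), …, F (t + b) = y;
-- lifted to ℤ its b steps lie in (0, n) and add up to a n, and a step lowers the representative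
-- in [1, n] exactly when it wraps around, so the cycle has a descents.

open import Defs

open import Algebra.Properties.CommutativeMonoid.Sum as CommutativeMonoidSum using ()
open import Data.Empty using (⊥-elim)
open import Data.Fin using (Fin; zero; suc; toℕ; fromℕ<)
import Data.Fin.Properties as Finₚ
open import Data.Fin.Permutation using (permutation)
open import Data.Integer as ℤ
  using (ℤ; +_; -[1+_]; 0ℤ; _+_; _-_; -_; _*_; _<_; _≤_; _<?_; +<+; +≤+; ∣_∣)
import Data.Integer.DivMod as ℤDiv
open import Data.Integer.DivMod using (_%ℕ_; _/ℕ_; n%ℕd<d; a≡a%ℕn+[a/ℕn]*n)
open import Data.Integer.Properties
open import Data.Integer.Tactic.RingSolver using (solve-∀)
open import Data.List using ([]; _∷_; _++_; filter; length; upTo)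
import Data.List.Properties as Listₚ
open import Data.Nat as ℕ using (ℕ; zero; suc; z≤n; s≤s)
import Data.Nat.Properties as ℕₚ
import Data.Nat.Coprimality as Coprimality
open import Data.Product using (∃; ∃-syntax; _×_; _,_; proj₁; proj₂)
import Data.Rational as ℚ
import Data.Rational.Properties as ℚₚ
import Data.Rational.Unnormalised as ℚᵘ
import Data.Rational.Unnormalised.Properties as ℚᵘₚ
open import Function using (_∘_)
open import Relation.Binary.PropositionalEquality
open import Relation.Binary.Definitions using (tri<; tri≈; tri>)
open import Relation.Nullary using (Dec; yes; no)
open import Relation.Unary using (Decidable)

open ≡-Reasoning

j-i+i≡j : ∀ j i → j - i + i ≡ j
j-i+i≡j = solve-∀

0<j-i⇒i<j : ∀ {i j} → 0ℤ < j - i → i < j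
0<j-i⇒i<j {i} {j} 0<j-i = subst₂ _<_ (+-identityˡ i) (j-i+i≡j j i) (+-monoˡ-< i 0<j-i)

j-i<0⇒j<i : ∀ {i j} → j - i < 0ℤ → j < i
j-i<0⇒j<i {i} {j} j-i<0 = subst₂ _<_ (j-i+i≡j j i) (+-identityˡ i) (+-monoˡ-< i j-i<0)

i<j⇒0<j-i : ∀ {i j} → i < j → 0ℤ < j - i
i<j⇒0<j-i {i} {j} i<j = subst (_< j - i) (+-inverseʳ i) (+-monoˡ-< (- i) i<j)

i<j+k⇒i-j<k : ∀ {i j k} → i < j + k → i - j < k
i<j+k⇒i-j<k {i} {j} {k} i<j+k = subst (i - j <_) (eq j k) (+-monoˡ-< (- j) i<j+k)
  where
  eq : ∀ j k → j + k - j ≡ k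
  eq = solve-∀

0≤i⇒0≤+n*i : ∀ n {i} → 0ℤ ≤ i → 0ℤ ≤ + n * i
0≤i⇒0≤+n*i n {i} 0≤i = subst (_≤ + n * i) (*-zeroʳ (+ n)) (*-monoˡ-≤-nonNeg (+ n) 0≤i)

i≤0⇒+n*i≤0 : ∀ n {i} → i ≤ 0ℤ → + n * i ≤ 0ℤ
i≤0⇒+n*i≤0 n {i} i≤0 = subst (+ n * i ≤_) (*-zeroʳ (+ n)) (*-monoˡ-≤-nonNeg (+ n) i≤0)

sum< : ℕ → (ℕ → ℤ) → ℤ
sum< zero    h = 0ℤ
sum< (suc n) h = sum< n h + h n

sum<-cong : ∀ n {g h : ℕ → ℤ} → (∀ t → t ℕ.< n → g t ≡ h t) → sum< n g ≡ sum< n h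
sum<-cong zero    g≗h = refl
sum<-cong (suc n) g≗h =
  cong₂ _+_ (sum<-cong n (λ t t<n → g≗h t (ℕₚ.m<n⇒m<1+n t<n))) (g≗h n (ℕₚ.n<1+n n))

sum<-distrib-+ : ∀ n (g h : ℕ → ℤ) → sum< n (λ t → g t + h t) ≡ sum< n g + sum< n h
sum<-distrib-+ zero    g h = refl
sum<-distrib-+ (suc n) g h =
  trans (cong (_+ (g n + h n)) (sum<-distrib-+ n g h)) (exchange (sum< n g) (sum< n h) (g n) (h n))
  where
  exchange : ∀ a b c d → a + b + (c + d) ≡ a + c + (b + d)
  exchange = solve-∀

sum<-const : ∀ n c → sum< n (λ _ → c) ≡ + n * c
sum<-const zero    c = sym (*-zeroˡ c)
sum<-const (suc n) c = begin
  sum< n (λ _ → c) + c ≡⟨ cong (_+ c) (sum<-const n c) ⟩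
  + n * c + c          ≡⟨ +-comm (+ n * c) c ⟩
  c + + n * c          ≡⟨ suc-* (+ n) c ⟨
  + suc n * c          ∎

sum<-neg : ∀ n (h : ℕ → ℤ) → sum< n (-_ ∘ h) ≡ - sum< n h
sum<-neg zero    h = refl
sum<-neg (suc n) h = trans (cong (_- h n) (sum<-neg n h)) (sym (neg-distrib-+ (sum< n h) (h n)))

sum<-telescope : ∀ n (H : ℕ → ℤ) → sum< n (λ t → H (suc t) - H t) ≡ H n - H 0
sum<-telescope zero    H = sym (+-inverseʳ (H 0))
sum<-telescope (suc n) H = begin
  sum< n (λ t → H (suc t) - H t) + (H (suc n) - H n) ≡⟨ cong (_+ (H (suc n) - H n)) (sum<-telescope n H) ⟩
  (H n - H 0) + (H (suc n) - H n)                    ≡⟨ +-comm (H n - H 0) _ ⟩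
  (H (suc n) - H n) + (H n - H 0)                    ≡⟨ +-minus-telescope (H (suc n)) (H n) (H 0) ⟩
  H (suc n) - H 0                                    ∎

sum<-shift : ∀ N K (H : ℕ → ℤ) → (∀ t → H (N ℕ.+ t) ≡ H t + K) →
             ∀ b → sum< N (λ s → H (s ℕ.+ b) - H s) ≡ + b * K
sum<-shift N K H H-per zero = begin
  sum< N (λ s → H (s ℕ.+ 0) - H s) ≡⟨ sum<-cong N (λ s _ → trans (cong (λ u → H u - H s) (ℕₚ.+-identityʳ s))
                                                                 (+-inverseʳ (H s))) ⟩
  sum< N (λ _ → 0ℤ)                ≡⟨ sum<-const N 0ℤ ⟩
  + N * 0ℤ                         ≡⟨ *-zeroʳ (+ N) ⟩
  0ℤ                               ∎
sum<-shift N K H H-per (suc b) = begin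
  sum< N (λ s → H (s ℕ.+ suc b) - H s)
    ≡⟨ sum<-cong N (λ s _ → split s) ⟩
  sum< N (λ s → (H (suc s ℕ.+ b) - H (suc s)) + (H (suc s) - H s))
    ≡⟨ sum<-distrib-+ N _ _ ⟩
  sum< N (λ s → H (suc s ℕ.+ b) - H (suc s)) + sum< N (λ s → H (suc s) - H s)
    ≡⟨ cong₂ _+_ (sum<-shift N K (H ∘ suc) (λ t → trans (cong H (sym (ℕₚ.+-suc N t))) (H-per (suc t))) b)
                 (sum<-telescope N H) ⟩
  + b * K + (H N - H 0)
    ≡⟨ cong (λ x → + b * K + (x - H 0)) (trans (cong H (sym (ℕₚ.+-identityʳ N))) (H-per 0)) ⟩
  + b * K + (H 0 + K - H 0)
    ≡⟨ eq (+ b) K (H 0) ⟩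
  + suc b * K
    ∎
  where
  split : ∀ s → H (s ℕ.+ suc b) - H s ≡ (H (suc s ℕ.+ b) - H (suc s)) + (H (suc s) - H s)
  split s = trans (cong (λ u → H u - H s) (ℕₚ.+-suc s b))
                  (sym (+-minus-telescope (H (suc s ℕ.+ b)) (H (suc s)) (H s)))
  eq : ∀ b K h → b * K + (h + K - h) ≡ (+ 1 + b) * K
  eq = solve-∀

module ∑ℤ = CommutativeMonoidSum +-0-commutativeMonoid

sum<≡∑ : ∀ n (h : ℕ → ℤ) → sum< n h ≡ ∑ℤ.sum {n} (h ∘ toℕ)
sum<≡∑ zero    h = refl
sum<≡∑ (suc n) h = trans (sum<-unfoldˡ n h) (cong (λ x → h 0 + x) (sum<≡∑ n (h ∘ suc)))
  where
  sum<-unfoldˡ : ∀ n (h : ℕ → ℤ) → sum< (suc n) h ≡ h 0 + sum< n (h ∘ suc)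
  sum<-unfoldˡ zero    h = trans (+-identityˡ (h 0)) (sym (+-identityʳ (h 0)))
  sum<-unfoldˡ (suc n) h = trans (cong (_+ h (suc n)) (sum<-unfoldˡ n h)) (+-assoc (h 0) _ _)

sumTo≡sum< : ∀ n (g : ℤ → ℤ) → sumTo n g ≡ sum< n (λ t → g (+ suc t))
sumTo≡sum< zero    g = refl
sumTo≡sum< (suc n) g = cong (_+ g (+ suc n)) (sumTo≡sum< n g)

nonneg-sum⇒positive-term : ∀ n (h : ℕ → ℤ) → (∀ t → h t ≢ 0ℤ) →
                           0ℤ ≤ sum< (suc n) h → ∃[ t ] t ℕ.< suc n × 0ℤ < h t
nonneg-sum⇒positive-term n h h≢0 0≤Σ with 0ℤ <? h n
... | yes 0<hn = n , ℕₚ.n<1+n n , 0<hn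
nonneg-sum⇒positive-term zero h h≢0 0≤Σ | no 0≮h0 =
  ⊥-elim (h≢0 0 (≤-antisym (≮⇒≥ 0≮h0) (subst (0ℤ ≤_) (+-identityˡ (h 0)) 0≤Σ)))
nonneg-sum⇒positive-term (suc n) h h≢0 0≤Σ | no 0≮hn =
  let t , t<n , 0<ht = nonneg-sum⇒positive-term n h h≢0 0≤Σ' in t , ℕₚ.m<n⇒m<1+n t<n , 0<ht
  where
  Σ = sum< (suc n) h
  0≤Σ' : 0ℤ ≤ Σ
  0≤Σ' = ≤-trans 0≤Σ (subst (Σ + h (suc n) ≤_) (+-identityʳ Σ) (+-monoʳ-≤ Σ (≮⇒≥ 0≮hn)))

nonpos-sum⇒negative-term : ∀ n (h : ℕ → ℤ) → (∀ t → h t ≢ 0ℤ) →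
                           sum< (suc n) h ≤ 0ℤ → ∃[ t ] t ℕ.< suc n × h t < 0ℤ
nonpos-sum⇒negative-term n h h≢0 Σ≤0 =
  let t , t<n , 0<-ht = nonneg-sum⇒positive-term n (-_ ∘ h) (λ t → h≢0 t ∘ neg-injective)
                          (subst (0ℤ ≤_) (sym (sum<-neg (suc n) h)) (neg-mono-≤ Σ≤0))
  in t , t<n , neg-cancel-< 0<-ht

sign-change : (D : ℕ → ℤ) → (∀ t → D t ≢ 0ℤ) → ∀ d s → D s < 0ℤ → 0ℤ < D (s ℕ.+ d) →
              ∃[ t ] D t < 0ℤ × 0ℤ < D (suc t)
sign-change D D≢0 zero    s Ds<0 0<Ds+d = ⊥-elim (<-asym Ds<0 (subst (λ u → 0ℤ < D u) (ℕₚ.+-identityʳ s) 0<Ds+d))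
sign-change D D≢0 (suc d) s Ds<0 0<Ds+d with 0ℤ <? D (suc s)
... | yes 0<Ds+1 = s , Ds<0 , 0<Ds+1
... | no  0≮Ds+1 = sign-change D D≢0 d (suc s) (≤∧≢⇒< (≮⇒≥ 0≮Ds+1) (D≢0 (suc s)))
                     (subst (λ u → 0ℤ < D u) (ℕₚ.+-suc s d) 0<Ds+d)

injective⇒surjective : ∀ {n} (g : Fin n → Fin n) → (∀ {i j} → g i ≡ g j → i ≡ j) →
                       ∀ y → ∃[ i ] g i ≡ y
injective⇒surjective {n} g g-inj y with Finₚ.pigeonhole (ℕₚ.n<1+n n) extended
  where
  extended : Fin (suc n) → Fin n
  extended zero    = y
  extended (suc i) = g i
... | zero  , suc j , _   , y≡gj = j , sym y≡gj
... | suc i , suc j , i<j , gi≡gj = ⊥-elim (ℕₚ.<-irrefl (cong toℕ (g-inj gi≡gj)) (ℕ.s<s⁻¹ i<j))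

indicator : ∀ {p} {P : Set p} → Dec P → ℕ
indicator (yes _) = 1
indicator (no _)  = 0

length-filter-upTo-suc : ∀ {p} {P : ℕ → Set p} (P? : Decidable P) n →
  length (filter P? (upTo (suc n))) ≡ length (filter P? (upTo n)) ℕ.+ indicator (P? n)
length-filter-upTo-suc {P = P} P? n = begin
  length (filter P? (upTo (suc n)))                       ≡⟨ cong (length ∘ filter P?) (Listₚ.upTo-∷ʳ n) ⟨
  length (filter P? (upTo n ++ n ∷ []))                   ≡⟨ cong length (Listₚ.filter-++ P? (upTo n) (n ∷ [])) ⟩
  length (filter P? (upTo n) ++ filter P? (n ∷ []))       ≡⟨ Listₚ.length-++ (filter P? (upTo n)) ⟩
  length (filter P? (upTo n)) ℕ.+ length (filter P? (n ∷ [])) ≡⟨ cong (length (filter P? (upTo n)) ℕ.+_)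
                                                                      (singleton (P? n)) ⟩
  length (filter P? (upTo n)) ℕ.+ indicator (P? n)        ∎
  where
  singleton : (Pn? : Dec (P n)) → length (filter P? (n ∷ [])) ≡ indicator Pn?
  singleton (yes Pn) = cong length (Listₚ.filter-accept P? Pn)
  singleton (no ¬Pn) = cong length (Listₚ.filter-reject P? ¬Pn)

iterℕ-+ : ∀ (g : ℤ → ℤ) s t x → iterℕ (s ℕ.+ t) g x ≡ iterℕ s g (iterℕ t g x)
iterℕ-+ g zero    t x = refl
iterℕ-+ g (suc s) t x = cong g (iterℕ-+ g s t x)

iterℕ-comm : ∀ (g : ℤ → ℤ) s t x → iterℕ s g (iterℕ t g x) ≡ iterℕ t g (iterℕ s g x)
iterℕ-comm g s t x = begin
  iterℕ s g (iterℕ t g x) ≡⟨ iterℕ-+ g s t x ⟨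
  iterℕ (s ℕ.+ t) g x     ≡⟨ cong (λ u → iterℕ u g x) (ℕₚ.+-comm s t) ⟩
  iterℕ (t ℕ.+ s) g x     ≡⟨ iterℕ-+ g t s x ⟩
  iterℕ t g (iterℕ s g x) ∎

-- For the orbit o of i under the swapped permutation, this is the k₁ of the definition of F'(f).
descents : (ℕ → ℤ) → ℕ → ℕ
descents o b = length (filter (λ u → o (suc u) <? o u) (upTo b))

module Residues (m : ℕ) where

  N : ℕ
  N = suc m

  quotient : ℤ → ℤ
  quotient x = (x - + 1) /ℕ N

  rep≡rep+quotient : ∀ x → x ≡ rep N x + quotient x * + N
  rep≡rep+quotient x = begin
    x                                                 ≡⟨ shift x ⟩
    (x - + 1) + + 1                                    ≡⟨ cong (_+ + 1) (a≡a%ℕn+[a/ℕn]*n (x - + 1) N) ⟩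
    + ((x - + 1) %ℕ N) + quotient x * + N + + 1        ≡⟨ reorder (+ ((x - + 1) %ℕ N)) (quotient x * + N) ⟩
    + 1 + + ((x - + 1) %ℕ N) + quotient x * + N        ∎
    where
    shift : ∀ x → x ≡ (x - + 1) + + 1
    shift = solve-∀
    reorder : ∀ r q → r + q + + 1 ≡ + 1 + r + q
    reorder = solve-∀

  rep-lower : ∀ x → + 1 ≤ rep N x
  rep-lower x = +≤+ (s≤s z≤n)

  rep-upper : ∀ x → rep N x ≤ + N
  rep-upper x = +≤+ (n%ℕd<d (x - + 1) N)

  congruent-in-range : ∀ {i j} p q → 0ℤ ≤ i → i < + N → 0ℤ ≤ j → j < + N →
                       i + p * + N ≡ j + q * + N → i ≡ j
  congruent-in-range {+ r} {+ s} p q _ (+<+ r<N) _ (+<+ s<N) eq =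
    i-j≡0⇒i≡j (+ r) (+ s) (trans r-s≡dN (cong (_* + N) d≡0))
    where
    d = q - p
    r-s≡dN : + r - + s ≡ d * + N
    r-s≡dN = trans (move (+ r) (+ s) p (+ N)) (trans (cong (λ x → x - + s - p * + N) eq) (cancel (+ s) q p (+ N)))
      where
      move : ∀ r s p n → r - s ≡ (r + p * n) - s - p * n
      move = solve-∀
      cancel : ∀ s q p n → s + q * n - s - p * n ≡ (q - p) * n
      cancel = solve-∀
    ∣d∣N<N : ∣ d ∣ ℕ.* N ℕ.< N
    ∣d∣N<N = subst (ℕ._< N) (abs-* d (+ N))
      (ℕₚ.≤-<-trans (subst (λ x → ∣ x ∣ ℕ.≤ r ℕ.⊔ s) (trans (sym (m-n≡m⊖n r s)) r-s≡dN) (∣m⊝n∣≤m⊔n r s))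
                    (ℕₚ.⊔-lub r<N s<N))
    d≡0 : d ≡ 0ℤ
    d≡0 = ∣i∣≡0⇒i≡0 (ℕₚ.n<1⇒n≡0
            (ℕₚ.*-cancelʳ-< N ∣ d ∣ 1 (subst (∣ d ∣ ℕ.* N ℕ.<_) (sym (ℕₚ.*-identityˡ N)) ∣d∣N<N)))

  rep-char : ∀ x r q → r ℕ.< N → x ≡ + suc r + q * + N → rep N x ≡ + suc r
  rep-char x r q r<N x≡ = cong (+_ ∘ suc) (+-injective
    (congruent-in-range (quotient x) q (+≤+ z≤n) (+<+ (n%ℕd<d (x - + 1) N)) (+≤+ z≤n) (+<+ r<N) eq))
    where
    drop-one : ∀ r q → + 1 + r + q - + 1 ≡ r + q
    drop-one = solve-∀
    eq : + ((x - + 1) %ℕ N) + quotient x * + N ≡ + r + q * + N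
    eq = trans (sym (a≡a%ℕn+[a/ℕn]*n (x - + 1) N)) (trans (cong (_- + 1) x≡) (drop-one (+ r) (q * + N)))

  rep-+* : ∀ x c → rep N (x + c * + N) ≡ rep N x
  rep-+* x c = rep-char (x + c * + N) ((x - + 1) %ℕ N) (quotient x + c) (n%ℕd<d (x - + 1) N)
    (trans (cong (_+ c * + N) (rep≡rep+quotient x)) (collect (rep N x) (quotient x) c (+ N)))
    where
    collect : ∀ r q c n → r + q * n + c * n ≡ r + (q + c) * n
    collect = solve-∀

  rep-fix : ∀ u → + 1 ≤ u → u ≤ + N → rep N u ≡ u
  rep-fix (+ zero)  (+≤+ ()) _
  rep-fix (+ suc r) _ (+≤+ r<N) = rep-char (+ suc r) r 0ℤ r<N (sym (+-identityʳ (+ suc r)))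

  rep-idem : ∀ x → rep N (rep N x) ≡ rep N x
  rep-idem x = rep-fix (rep N x) (rep-lower x) (rep-upper x)

  rep-≡⇒ : ∀ x y → rep N x ≡ rep N y → y ≡ x + (quotient y - quotient x) * + N
  rep-≡⇒ x y eq = begin
    y                                                    ≡⟨ rep≡rep+quotient y ⟩
    rep N y + quotient y * + N                           ≡⟨ cong (_+ quotient y * + N) eq ⟨
    rep N x + quotient y * + N                           ≡⟨ shift (rep N x) (quotient x) (quotient y) (+ N) ⟩
    (rep N x + quotient x * + N) + (quotient y - quotient x) * + N
                                                         ≡⟨ cong (_+ (quotient y - quotient x) * + N) (rep≡rep+quotient x) ⟨
    x + (quotient y - quotient x) * + N                  ∎
    where
    shift : ∀ r p q n → r + q * n ≡ (r + p * n) + (q - p) * n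
    shift = solve-∀

  residue : ℤ → Fin N
  residue x = fromℕ< (n%ℕd<d (x - + 1) N)

  rep≡suc-residue : ∀ x → rep N x ≡ + suc (toℕ (residue x))
  rep≡suc-residue x = cong (+_ ∘ suc) (sym (Finₚ.toℕ-fromℕ< (n%ℕd<d (x - + 1) N)))

  difference≡rep-difference : ∀ u v →
    v - u + quotient u * + N ≡ rep N v - rep N u + quotient v * + N
  difference≡rep-difference u v = begin
    v - u + quotient u * + N
      ≡⟨ cong₂ (λ a b → a - b + quotient u * + N) (rep≡rep+quotient v) (rep≡rep+quotient u) ⟩
    (rep N v + quotient v * + N) - (rep N u + quotient u * + N) + quotient u * + N
      ≡⟨ cancel (rep N v) (rep N u) (quotient v * + N) (quotient u * + N) ⟩
    rep N v - rep N u + quotient v * + N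
      ∎
    where
    cancel : ∀ V U a b → (V + a) - (U + b) + b ≡ V - U + a
    cancel = solve-∀

  residue-step : ∀ {u v} → u < v → v < u + + N →
                 v - u ≡ rep N v - rep N u + + N * + indicator (rep N v <? rep N u)
  residue-step {u} {v} u<v v<u+N with rep N v <? rep N u
  ... | no V≮U = begin
    v - u              ≡⟨ congruent-in-range (quotient u) (quotient v) (<⇒≤ (i<j⇒0<j-i u<v)) (i<j+k⇒i-j<k v<u+N)
                            (i≤j⇒0≤j-i (≮⇒≥ V≮U)) (i<j+k⇒i-j<k {j = U} V<U+N) (difference≡rep-difference u v) ⟩
    V - U              ≡⟨ +-identityʳ (V - U) ⟨
    V - U + 0ℤ         ≡⟨ cong (λ x → V - U + x) (*-zeroʳ (+ N)) ⟨
    V - U + + N * + 0  ∎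
    where
    V = rep N v
    U = rep N u
    V<U+N : V < U + + N
    V<U+N = ≤-<-trans (rep-upper v) (+<+ (s≤s (ℕₚ.m≤n+m N _)))
  ... | yes V<U = begin
    v - u              ≡⟨ congruent-in-range (quotient u) (quotient v - + 1) (<⇒≤ (i<j⇒0<j-i u<v)) (i<j+k⇒i-j<k v<u+N)
                            0≤V-U+N V-U+N<N
                            (trans (difference≡rep-difference u v) (borrow V U (quotient v) (+ N))) ⟩
    V - U + + N        ≡⟨ cong (λ x → V - U + x) (*-identityʳ (+ N)) ⟨
    V - U + + N * + 1  ∎
    where
    V = rep N v
    U = rep N u
    borrow : ∀ V U q n → V - U + q * n ≡ (V - U + n) + (q - + 1) * n
    borrow = solve-∀
    reorder : ∀ V U n → V + (n - U) ≡ V - U + n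
    reorder = solve-∀
    0≤V-U+N : 0ℤ ≤ V - U + + N
    0≤V-U+N = subst (0ℤ ≤_) (reorder V U (+ N)) (+-mono-≤ (+≤+ z≤n) (i≤j⇒0≤j-i (rep-upper u)))
    V-U+N<N : V - U + + N < + N
    V-U+N<N = subst (V - U + + N <_) (+-identityˡ (+ N))
                (+-monoˡ-< (+ N) (subst (V - U <_) (+-inverseʳ U) (+-monoˡ-< (- U) V<U)))

  lift-descents : ∀ (z o : ℕ → ℤ) b → (∀ u → u ℕ.≤ b → rep N (z u) ≡ o u) →
                  (∀ u → u ℕ.< b → z u < z (suc u) × z (suc u) < z u + + N) →
                  z b - z 0 ≡ o b - o 0 + + N * + descents o b
  lift-descents z o zero    rep-z steps =
    trans (+-inverseʳ (z 0)) (sym (cong₂ _+_ (+-inverseʳ (o 0)) (*-zeroʳ (+ N))))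
  lift-descents z o (suc b) rep-z steps = begin
    z (suc b) - z 0
      ≡⟨ +-minus-telescope (z (suc b)) (z b) (z 0) ⟨
    (z (suc b) - z b) + (z b - z 0)
      ≡⟨ cong₂ _+_ last-step (lift-descents z o b (λ u u≤b → rep-z u (ℕₚ.m≤n⇒m≤1+n u≤b))
                                                (λ u u<b → steps u (ℕₚ.m<n⇒m<1+n u<b))) ⟩
    (o (suc b) - o b + + N * + indicator (o (suc b) <? o b)) + (o b - o 0 + + N * + descents o b)
      ≡⟨ collect (o (suc b)) (o b) (o 0) (+ N) (+ indicator (o (suc b) <? o b)) (+ descents o b) ⟩
    o (suc b) - o 0 + + N * (+ descents o b + + indicator (o (suc b) <? o b))
      ≡⟨ cong (λ x → o (suc b) - o 0 + + N * x) (pos-+ (descents o b) _) ⟨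
    o (suc b) - o 0 + + N * + (descents o b ℕ.+ indicator (o (suc b) <? o b))
      ≡⟨ cong (λ x → o (suc b) - o 0 + + N * + x) (length-filter-upTo-suc (λ u → o (suc u) <? o u) b) ⟨
    o (suc b) - o 0 + + N * + descents o (suc b)
      ∎
    where
    last-step : z (suc b) - z b ≡ o (suc b) - o b + + N * + indicator (o (suc b) <? o b)
    last-step = trans (residue-step (proj₁ (steps b (ℕₚ.n<1+n b))) (proj₂ (steps b (ℕₚ.n<1+n b))))
      (cong₂ (λ X Y → X - Y + + N * + indicator (X <? Y)) (rep-z (suc b) ℕₚ.≤-refl) (rep-z b (ℕₚ.n≤1+n b)))
    collect : ∀ x y z n i d → (x - y + n * i) + (y - z + n * d) ≡ x - z + n * (d + i)
    collect = solve-∀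

module Orbit {k m : ℕ} {f : ℤ → ℤ} (θ : IsTheta k (suc m) f) where

  open Residues m public
  open IsTheta θ

  f-injective : ∀ {x y} → f x ≡ f y → x ≡ y
  f-injective {x} {y} fx≡fy = trans (sym (finv-f x)) (trans (cong finv fx≡fy) (finv-f y))

  f-+*ℕ : ∀ x n → f (x + + n * + N) ≡ f x + + n * + N
  f-+*ℕ x zero    = trans (cong f (+-identityʳ x)) (sym (+-identityʳ (f x)))
  f-+*ℕ x (suc n) = begin
    f (x + + suc n * + N)   ≡⟨ cong f (split x (+ n) (+ N)) ⟩
    f (x + + n * + N + + N) ≡⟨ periodic (x + + n * + N) ⟩
    f (x + + n * + N) + + N ≡⟨ cong (_+ + N) (f-+*ℕ x n) ⟩
    f x + + n * + N + + N   ≡⟨ split (f x) (+ n) (+ N) ⟨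
    f x + + suc n * + N     ∎
    where
    split : ∀ x a n → x + (+ 1 + a) * n ≡ x + a * n + n
    split = solve-∀

  f-+* : ∀ x c → f (x + c * + N) ≡ f x + c * + N
  f-+* x (+ n)      = f-+*ℕ x n
  f-+* x -[1+ n ]   = begin
    f y                                        ≡⟨ cancel (f y) (+ suc n) (+ N) ⟨
    f y + + suc n * + N + -[1+ n ] * + N       ≡⟨ cong (_+ -[1+ n ] * + N) (f-+*ℕ y (suc n)) ⟨
    f (y + + suc n * + N) + -[1+ n ] * + N     ≡⟨ cong (λ z → f z + -[1+ n ] * + N) (cancel x (- + suc n) (+ N)) ⟩
    f x + -[1+ n ] * + N                       ∎
    where
    y = x + -[1+ n ] * + N
    cancel : ∀ z a n → z + a * n + (- a) * n ≡ z
    cancel = solve-∀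

  iterℕ-+* : ∀ t x c → iterℕ t f (x + c * + N) ≡ iterℕ t f x + c * + N
  iterℕ-+* zero    x c = refl
  iterℕ-+* (suc t) x c = trans (cong f (iterℕ-+* t x c)) (f-+* (iterℕ t f x) c)

  rep-f-≡ : ∀ {x y} → rep N x ≡ rep N y → rep N (f x) ≡ rep N (f y)
  rep-f-≡ {x} {y} eq = sym (begin
    rep N (f y)                  ≡⟨ cong (rep N ∘ f) (rep-≡⇒ x y eq) ⟩
    rep N (f (x + c * + N))      ≡⟨ cong (rep N) (f-+* x c) ⟩
    rep N (f x + c * + N)        ≡⟨ rep-+* (f x) c ⟩
    rep N (f x)                  ∎)
    where
    c = quotient y - quotient x

  rep-f-injective : ∀ {x y} → rep N (f x) ≡ rep N (f y) → rep N x ≡ rep N y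
  rep-f-injective {x} {y} eq = sym (begin
    rep N y                ≡⟨ cong (rep N) (f-injective (trans (rep-≡⇒ (f x) (f y) eq) (sym (f-+* x c)))) ⟩
    rep N (x + c * + N)    ≡⟨ rep-+* x c ⟩
    rep N x                ∎)
    where
    c = quotient (f y) - quotient (f x)

  rep-iterℕ-≡ : ∀ t {x y} → rep N x ≡ rep N y → rep N (iterℕ t f x) ≡ rep N (iterℕ t f y)
  rep-iterℕ-≡ zero    eq = eq
  rep-iterℕ-≡ (suc t) eq = rep-f-≡ (rep-iterℕ-≡ t eq)

  rep-iterℕ-injective : ∀ t {x y} → rep N (iterℕ t f x) ≡ rep N (iterℕ t f y) → rep N x ≡ rep N y
  rep-iterℕ-injective zero    eq = eq
  rep-iterℕ-injective (suc t) eq = rep-iterℕ-injective t (rep-f-injective eq)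

  orbit : ℕ → ℤ
  orbit t = rep N (iterℕ t f (+ 1))

  orbit-no-return : ∀ {s t} → s ℕ.< t → t ℕ.< N → orbit s ≢ orbit t
  orbit-no-return {s} {t} s<t t<N eq =
    n-cycle (t ℕ.∸ s) (ℕₚ.m<n⇒0<n∸m s<t) (ℕₚ.≤-<-trans (ℕₚ.m∸n≤m t s) t<N) (sym (rep-iterℕ-injective s eq′))
    where
    t≡s+d : t ≡ s ℕ.+ (t ℕ.∸ s)
    t≡s+d = sym (ℕₚ.m+[n∸m]≡n (ℕₚ.<⇒≤ s<t))
    eq′ : rep N (iterℕ s f (+ 1)) ≡ rep N (iterℕ s f (iterℕ (t ℕ.∸ s) f (+ 1)))
    eq′ = trans eq (cong (rep N) (trans (cong (λ u → iterℕ u f (+ 1)) t≡s+d) (iterℕ-+ f s (t ℕ.∸ s) (+ 1))))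

  orbit-injective : ∀ {s t} → s ℕ.< N → t ℕ.< N → orbit s ≡ orbit t → s ≡ t
  orbit-injective {s} {t} s<N t<N eq with ℕₚ.<-cmp s t
  ... | tri< s<t _ _ = ⊥-elim (orbit-no-return s<t t<N eq)
  ... | tri≈ _ s≡t _ = s≡t
  ... | tri> _ _ t<s = ⊥-elim (orbit-no-return t<s s<N (sym eq))

  orbit-residue : Fin N → Fin N
  orbit-residue i = residue (iterℕ (toℕ i) f (+ 1))

  orbit≡suc-orbit-residue : ∀ i → orbit (toℕ i) ≡ + suc (toℕ (orbit-residue i))
  orbit≡suc-orbit-residue i = rep≡suc-residue (iterℕ (toℕ i) f (+ 1))

  orbit-residue-injective : ∀ {i j} → orbit-residue i ≡ orbit-residue j → i ≡ j
  orbit-residue-injective {i} {j} eq = Finₚ.toℕ-injective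
    (orbit-injective (Finₚ.toℕ<n i) (Finₚ.toℕ<n j)
      (trans (orbit≡suc-orbit-residue i) (trans (cong (+_ ∘ suc ∘ toℕ) eq) (sym (orbit≡suc-orbit-residue j)))))

  orbit-residue-surjective : ∀ y → ∃[ i ] orbit-residue i ≡ y
  orbit-residue-surjective = injective⇒surjective orbit-residue orbit-residue-injective

  orbit-surjective : ∀ y → ∃[ t ] orbit t ≡ rep N y
  orbit-surjective y =
    let i , eq = orbit-residue-surjective (residue y)
    in toℕ i , trans (orbit≡suc-orbit-residue i) (trans (cong (+_ ∘ suc ∘ toℕ) eq) (sym (rep≡suc-residue y)))

  no-short-cycle : ∀ y {d} → 0 ℕ.< d → d ℕ.< N → rep N (iterℕ d f y) ≢ rep N y
  no-short-cycle y {d} 0<d d<N eq with orbit-surjective y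
  ... | t , orbit-t≡y = n-cycle d 0<d d<N (rep-iterℕ-injective t (begin
    rep N (iterℕ t f (iterℕ d f (+ 1)))  ≡⟨ cong (rep N) (iterℕ-comm f t d (+ 1)) ⟩
    rep N (iterℕ d f (iterℕ t f (+ 1)))  ≡⟨ rep-iterℕ-≡ d orbit-t≡y ⟩
    rep N (iterℕ d f y)                  ≡⟨ eq ⟩
    rep N y                              ≡⟨ orbit-t≡y ⟨
    rep N (iterℕ t f (+ 1))              ∎))

  displacement : ℤ → ℤ
  displacement x = f x - x

  displacement-rep : ∀ x → displacement (rep N x) ≡ displacement x
  displacement-rep x = begin
    f (rep N x) - rep N x                          ≡⟨ cancel (f (rep N x)) (rep N x) (quotient x * + N) ⟨
    f (rep N x) + q - (rep N x + q)                ≡⟨ cong (_- (rep N x + q)) (f-+* (rep N x) (quotient x)) ⟨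
    f (rep N x + q) - (rep N x + q)                ≡⟨ cong displacement (rep≡rep+quotient x) ⟨
    f x - x                                        ∎
    where
    q = quotient x * + N
    cancel : ∀ a b d → a + d - (b + d) ≡ a - b
    cancel = solve-∀

  -- The orbit of 1 visits every residue once, so its total displacement is the sum condition.
  iterℕ-N-one : iterℕ N f (+ 1) ≡ + 1 + + k * + N
  iterℕ-N-one = trans (sym (subtract-one (iterℕ N f (+ 1)))) (cong (λ x → + 1 + x) (begin
    iterℕ N f (+ 1) - + 1
      ≡⟨ sum<-telescope N (λ t → iterℕ t f (+ 1)) ⟨
    sum< N (λ t → displacement (iterℕ t f (+ 1)))
      ≡⟨ sum<-cong N (λ t _ → displacement-rep (iterℕ t f (+ 1))) ⟨
    sum< N (displacement ∘ orbit)
      ≡⟨ sum<≡∑ N (displacement ∘ orbit) ⟩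
    ∑ℤ.sum {N} (displacement ∘ orbit ∘ toℕ)
      ≡⟨ ∑ℤ.sum-cong-≗ (cong displacement ∘ orbit≡suc-orbit-residue) ⟩
    ∑ℤ.sum {N} (λ i → displacement (+ suc (toℕ (orbit-residue i))))
      ≡⟨ ∑ℤ.∑-permute (λ i → displacement (+ suc (toℕ i))) π ⟨
    ∑ℤ.sum {N} (λ i → displacement (+ suc (toℕ i)))
      ≡⟨ sum<≡∑ N (λ t → displacement (+ suc t)) ⟨
    sum< N (λ t → displacement (+ suc t))
      ≡⟨ sumTo≡sum< N displacement ⟨
    sumTo N displacement
      ≡⟨ trans sum-cond (pos-* k N) ⟩
    + k * + N
      ∎))
    where
    π = permutation orbit-residue (proj₁ ∘ orbit-residue-surjective) (proj₂ ∘ orbit-residue-surjective)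
          (λ i → orbit-residue-injective (proj₂ (orbit-residue-surjective (orbit-residue i))))
    subtract-one : ∀ x → + 1 + (x - + 1) ≡ x
    subtract-one = solve-∀

  iterℕ-N : ∀ y → iterℕ N f y ≡ y + + k * + N
  iterℕ-N y with orbit-surjective y
  ... | t , orbit-t≡y = begin
    iterℕ N f y                                  ≡⟨ cong (iterℕ N f) y≡ ⟩
    iterℕ N f (z + c * + N)                      ≡⟨ iterℕ-+* N z c ⟩
    iterℕ N f z + c * + N                        ≡⟨ cong (_+ c * + N) (iterℕ-comm f N t (+ 1)) ⟩
    iterℕ t f (iterℕ N f (+ 1)) + c * + N        ≡⟨ cong (λ x → iterℕ t f x + c * + N) iterℕ-N-one ⟩
    iterℕ t f (+ 1 + + k * + N) + c * + N        ≡⟨ cong (_+ c * + N) (iterℕ-+* t (+ 1) (+ k)) ⟩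
    z + + k * + N + c * + N                      ≡⟨ swap z (+ k * + N) (c * + N) ⟩
    (z + c * + N) + + k * + N                    ≡⟨ cong (_+ + k * + N) y≡ ⟨
    y + + k * + N                                ∎
    where
    z = iterℕ t f (+ 1)
    c = quotient y - quotient z
    y≡ : y ≡ z + c * + N
    y≡ = rep-≡⇒ z y orbit-t≡y
    swap : ∀ a b c → a + b + c ≡ a + c + b
    swap = solve-∀

/1-floor : ∀ z → ℚ.floor (z ℚ./ 1) ≡ z
/1-floor z = begin
  ℚ.floor (z ℚ./ 1)   ≡⟨ cong ℚ.floor (ℚₚ.↥p/↧p≡p (ℚ.mkℚ z 0 (Coprimality.sym (Coprimality.1-coprimeTo ∣ z ∣)))) ⟩
  z ℤDiv./ + 1         ≡⟨ quotient≡ (z ℤDiv./ + 1) z (ℤDiv.a≡a%n+[a/n]*n z (+ 1)) ⟩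
  z                   ∎
  where
  quotient≡ : ∀ q z → z ≡ + (z ℤDiv.% + 1) + q * + 1 → q ≡ z
  quotient≡ q z eq =
    trans (sym (unit q)) (sym (trans eq (cong (λ r → + r + q * + 1) (ℕₚ.n<1⇒n≡0 (ℤDiv.n%d<d z (+ 1))))))
    where
    unit : ∀ q → + 0 + q * + 1 ≡ q
    unit = solve-∀

ψ-at-integer : ∀ {k n f} (θ : IsTheta k n f) z → ψ θ (z ℚ./ 1) ≡ pv θ z
ψ-at-integer θ z rewrite /1-floor z | ℚₚ.+-inverseʳ (z ℚ./ 1) =
  trans (cong₂ ℚ._+_ (ℚₚ.*-identityˡ (pv θ z)) (ℚₚ.*-zeroˡ (pv θ (z + + 1)))) (ℚₚ.+-identityʳ (pv θ z))

toℚᵘ-/ : ∀ x d → ℚ.toℚᵘ (x ℚ./ suc d) ℚᵘ.≃ ℚᵘ.mkℚᵘ x d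
toℚᵘ-/ x d = ℚₚ.toℚᵘ-fromℚᵘ (ℚᵘ.mkℚᵘ x d)

/-mono-< : ∀ {x y} d → x < y → x ℚ./ suc d ℚ.< y ℚ./ suc d
/-mono-< {x} {y} d x<y = ℚₚ.toℚᵘ-cancel-<
  (ℚᵘₚ.<-respˡ-≃ (ℚᵘₚ.≃-sym (toℚᵘ-/ x d)) (ℚᵘₚ.<-respʳ-≃ (ℚᵘₚ.≃-sym (toℚᵘ-/ y d))
    (ℚᵘ.*<* (*-monoʳ-<-pos (+ suc d) x<y))))

/≤/⇒*≤* : ∀ x y d e → x ℚ./ suc d ℚ.≤ y ℚ./ suc e → x * + suc e ≤ y * + suc d
/≤/⇒*≤* x y d e x/d≤y/e
  with ℚᵘₚ.≤-respʳ-≃ (toℚᵘ-/ y e) (ℚᵘₚ.≤-respˡ-≃ (toℚᵘ-/ x d) (ℚₚ.toℚᵘ-mono-≤ x/d≤y/e))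
... | ℚᵘ.*≤* xe≤yd = xe≤yd

/+/1 : ∀ x a d → x ℚ./ suc d ℚ.+ a ℚ./ 1 ≡ (x + a * + suc d) ℚ./ suc d
/+/1 x a d = ℚₚ.toℚᵘ-injective
  (ℚᵘₚ.≃-trans (ℚₚ.toℚᵘ-homo-+ (x ℚ./ suc d) (a ℚ./ 1))
  (ℚᵘₚ.≃-trans (ℚᵘₚ.+-cong (toℚᵘ-/ x d) (toℚᵘ-/ a 0))
  (ℚᵘₚ.≃-trans (ℚᵘ.*≡* cross) (ℚᵘₚ.≃-sym (toℚᵘ-/ (x + a * + suc d) d)))))
  where
  cross : (x * + 1 + a * + suc d) * + suc d ≡ (x + a * + suc d) * + suc (d ℕ.* 1)
  cross = trans (unit x a (+ suc d)) (cong (λ e → (x + a * + suc d) * + suc e) (sym (ℕₚ.*-identityʳ d)))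
    where
    unit : ∀ x a n → (x * + 1 + a * n) * n ≡ (x + a * n) * n
    unit = solve-∀

module Chords {k m : ℕ} {f : ℤ → ℤ} (θ : IsTheta k (suc m) f) (a b : ℕ) where

  open Orbit θ public

  F : ℕ → ℤ
  F s = iterℕ s f (+ 0)

  A : ℤ
  A = + a * + N

  F-+ : ∀ s t → F (s ℕ.+ t) ≡ iterℕ t f (F s)
  F-+ s t = trans (cong (λ u → iterℕ u f (+ 0)) (ℕₚ.+-comm s t)) (iterℕ-+ f t s (+ 0))

  F-+N : ∀ t → F (N ℕ.+ t) ≡ F t + + k * + N
  F-+N t = trans (iterℕ-+ f N t (+ 0)) (iterℕ-N (F t))

  D : ℕ → ℤ
  D s = F (s ℕ.+ b) - (F s + A)

  below-at : ∀ s → F s + A < F (s ℕ.+ b) → Below θ (qpt θ a b (+ s))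
  below-at s lt = subst₂ ℚ._<_ (sym (/+/1 (F s) (+ a) m)) (sym (ψ-at-integer θ (+ (s ℕ.+ b)))) (/-mono-< m lt)

  above-at : ∀ s → F (s ℕ.+ b) < F s + A → Above θ (qpt θ a b (+ s))
  above-at s lt = subst₂ ℚ._<_ (sym (ψ-at-integer θ (+ (s ℕ.+ b)))) (sym (/+/1 (F s) (+ a) m)) (/-mono-< m lt)

  sum-D : sum< N D ≡ + N * (+ k * + b - + a * + N)
  sum-D = begin
    sum< N D
      ≡⟨ sum<-cong N (λ s _ → split (F (s ℕ.+ b)) (F s) A) ⟩
    sum< N (λ s → (F (s ℕ.+ b) - F s) + - A)
      ≡⟨ sum<-distrib-+ N _ _ ⟩
    sum< N (λ s → F (s ℕ.+ b) - F s) + sum< N (λ _ → - A)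
      ≡⟨ cong₂ _+_ (sum<-shift N (+ k * + N) F F-+N b) (sum<-const N (- A)) ⟩
    + b * (+ k * + N) + + N * - (+ a * + N)
      ≡⟨ factor (+ b) (+ k) (+ N) (+ a) ⟩
    + N * (+ k * + b - + a * + N)
      ∎
    where
    split : ∀ u v A → u - (v + A) ≡ (u - v) + - A
    split = solve-∀
    factor : ∀ b k n a → b * (k * n) + n * - (a * n) ≡ n * (k * b - a * n)
    factor = solve-∀

  sum-D-nonneg : + a * + N ≤ + k * + b → 0ℤ ≤ sum< N D
  sum-D-nonneg aN≤kb = subst (0ℤ ≤_) (sym sum-D) (0≤i⇒0≤+n*i N (i≤j⇒0≤j-i aN≤kb))

  sum-D-nonpos : + k * + b ≤ + a * + N → sum< N D ≤ 0ℤ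
  sum-D-nonpos kb≤aN = subst (_≤ 0ℤ) (sym sum-D) (i≤0⇒+n*i≤0 N (i≤j⇒i-j≤0 kb≤aN))

  module _ (0<b : 0 ℕ.< b) (b<N : b ℕ.< N) where

    D≢0 : ∀ s → D s ≢ 0ℤ
    D≢0 s Ds≡0 = no-short-cycle (F s) 0<b b<N (begin
      rep N (iterℕ b f (F s))  ≡⟨ cong (rep N) (F-+ s b) ⟨
      rep N (F (s ℕ.+ b))      ≡⟨ cong (rep N) (i-j≡0⇒i≡j (F (s ℕ.+ b)) (F s + A) Ds≡0) ⟩
      rep N (F s + A)          ≡⟨ rep-+* (F s) (+ a) ⟩
      rep N (F s)              ∎)

    D-+N : ∀ s → D (N ℕ.+ s) ≡ D s
    D-+N s = begin
      F (N ℕ.+ s ℕ.+ b) - (F (N ℕ.+ s) + A)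
        ≡⟨ cong (λ u → F u - (F (N ℕ.+ s) + A)) (ℕₚ.+-assoc N s b) ⟩
      F (N ℕ.+ (s ℕ.+ b)) - (F (N ℕ.+ s) + A)
        ≡⟨ cong₂ (λ u v → u - (v + A)) (F-+N (s ℕ.+ b)) (F-+N s) ⟩
      F (s ℕ.+ b) + + k * + N - (F s + + k * + N + A)
        ≡⟨ cancel (F (s ℕ.+ b)) (F s) (+ k * + N) A ⟩
      F (s ℕ.+ b) - (F s + A)
        ∎
      where
      cancel : ∀ u v K A → u + K - (v + K + A) ≡ u - (v + A)
      cancel = solve-∀

    below-exists : + a * + N ≤ + k * + b → ∃[ r ] Below θ (qpt θ a b r)
    below-exists aN≤kb =
      let s , _ , 0<Ds = nonneg-sum⇒positive-term m D D≢0 (sum-D-nonneg aN≤kb)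
      in + s , below-at s (0<j-i⇒i<j 0<Ds)

    above-exists : + k * + b ≤ + a * + N → ∃[ r ] Above θ (qpt θ a b r)
    above-exists kb≤aN =
      let s , _ , Ds<0 = nonpos-sum⇒negative-term m D D≢0 (sum-D-nonpos kb≤aN)
      in + s , above-at s (j-i<0⇒j<i Ds<0)

    sign-change-of-D : + a * + N ≡ + k * + b → ∃[ t ] D t < 0ℤ × 0ℤ < D (suc t)
    sign-change-of-D aN≡kb =
      let s₀ , s₀<N , Ds₀<0 = nonpos-sum⇒negative-term m D D≢0 (sum-D-nonpos (≤-reflexive (sym aN≡kb)))
          s₁ , _    , 0<Ds₁ = nonneg-sum⇒positive-term m D D≢0 (sum-D-nonneg (≤-reflexive aN≡kb))
      in sign-change D D≢0 (N ℕ.+ s₁ ℕ.∸ s₀) s₀ Ds₀<0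
           (subst (λ u → 0ℤ < D u) (sym (ℕₚ.m+[n∸m]≡n (ℕₚ.≤-trans (ℕₚ.<⇒≤ s₀<N) (ℕₚ.m≤m+n N s₁))))
                  (subst (0ℤ <_) (sym (D-+N s₁)) 0<Ds₁))

swapVals-at-i : ∀ n f i j z → rep n z ≡ rep n i → swapVals n f i j z ≡ f (z + (j - i))
swapVals-at-i n f i j z z≡i with rep n z ℤ.≟ rep n i
... | yes _   = refl
... | no  z≢i = ⊥-elim (z≢i z≡i)

swapVals-elsewhere : ∀ n f i j z → rep n z ≢ rep n i → rep n z ≢ rep n j → swapVals n f i j z ≡ f z
swapVals-elsewhere n f i j z z≢i z≢j with rep n z ℤ.≟ rep n i | rep n z ℤ.≟ rep n j
... | yes z≡i | _       = ⊥-elim (z≢i z≡i)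
... | no _    | yes z≡j = ⊥-elim (z≢j z≡j)
... | no _    | no _    = refl

module Inversion {k m : ℕ} {f : ℤ → ℤ} (θ : IsTheta k (suc m) f) (a b : ℕ)
                 (0<b : 0 ℕ.< b) (b<N : b ℕ.< suc m)
                 (t : ℕ) (Dt<0 : Chords.D θ a b t < 0ℤ) (0<Dt+1 : 0ℤ < Chords.D θ a b (suc t)) where

  open Chords θ a b
  open IsTheta θ using (lower; upper)

  y x : ℤ
  y = F (t ℕ.+ b)
  x = F t + A

  y<x : y < x
  y<x = j-i<0⇒j<i Dt<0

  fx≡ : f x ≡ F (suc t) + A
  fx≡ = f-+* (F t) (+ a)

  fx<fy : f x < f y
  fx<fy = subst (_< f y) (sym fx≡) (0<j-i⇒i<j 0<Dt+1)

  -- The inversion (y, x) of f, translated by a multiple of N so that its first entry lies in [1, N].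
  c : ℤ
  c = - quotient y

  i j : ℤ
  i = rep N y
  j = x + c * + N

  i≡ : i ≡ y + c * + N
  i≡ = trans (cancel i (quotient y) (+ N)) (cong (λ z → z + c * + N) (sym (rep≡rep+quotient y)))
    where
    cancel : ∀ r q n → r ≡ r + q * n + (- q) * n
    cancel = solve-∀

  i<j : i < j
  i<j = subst (_< j) (sym i≡) (+-monoˡ-< (c * + N) y<x)

  fj<fi : f j < f i
  fj<fi = subst₂ _<_ (sym (f-+* x c)) (sym (trans (cong f i≡) (f-+* y c))) (+-monoˡ-< (c * + N) fx<fy)

  g̅ : ℤ → ℤ
  g̅ z = rep N (swapVals N f i j z)

  orb : ℕ → ℤ
  orb u = iterℕ u g̅ i

  rep-i : rep N i ≡ i
  rep-i = rep-idem y

  rep-j : rep N j ≡ rep N (F t)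
  rep-j = trans (rep-+* x c) (rep-+* (F t) (+ a))

  F-avoids-i : ∀ u → u ℕ.< b → rep N (F (t ℕ.+ u)) ≢ rep N i
  F-avoids-i u u<b eq =
    no-short-cycle (F (t ℕ.+ u)) (ℕₚ.m<n⇒0<n∸m u<b) (ℕₚ.≤-<-trans (ℕₚ.m∸n≤m b u) b<N) (begin
      rep N (iterℕ (b ℕ.∸ u) f (F (t ℕ.+ u)))  ≡⟨ cong (rep N) (F-+ (t ℕ.+ u) (b ℕ.∸ u)) ⟨
      rep N (F (t ℕ.+ u ℕ.+ (b ℕ.∸ u)))        ≡⟨ cong (rep N ∘ F) t+u+[b-u]≡t+b ⟩
      rep N y                                  ≡⟨ trans (sym rep-i) (sym eq) ⟩
      rep N (F (t ℕ.+ u))                      ∎)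
    where
    t+u+[b-u]≡t+b : t ℕ.+ u ℕ.+ (b ℕ.∸ u) ≡ t ℕ.+ b
    t+u+[b-u]≡t+b = trans (ℕₚ.+-assoc t u _) (cong (t ℕ.+_) (ℕₚ.m+[n∸m]≡n (ℕₚ.<⇒≤ u<b)))

  F-avoids-j : ∀ u → 0 ℕ.< u → u ℕ.< b → rep N (F (t ℕ.+ u)) ≢ rep N j
  F-avoids-j u 0<u u<b eq =
    no-short-cycle (F t) 0<u (ℕₚ.<-trans u<b b<N) (trans (cong (rep N) (sym (F-+ t u))) (trans eq rep-j))

  orb-1 : orb 1 ≡ rep N (F (t ℕ.+ 1))
  orb-1 = begin
    rep N (swapVals N f i j i)   ≡⟨ cong (rep N) (swapVals-at-i N f i j i refl) ⟩
    rep N (f (i + (j - i)))      ≡⟨ cong (rep N ∘ f) (cancel i j) ⟩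
    rep N (f (x + c * + N))      ≡⟨ cong (rep N) (f-+* x c) ⟩
    rep N (f x + c * + N)        ≡⟨ rep-+* (f x) c ⟩
    rep N (f x)                  ≡⟨ cong (rep N) fx≡ ⟩
    rep N (F (suc t) + A)        ≡⟨ rep-+* (F (suc t)) (+ a) ⟩
    rep N (F (suc t))            ≡⟨ cong (rep N ∘ F) (ℕₚ.+-comm 1 t) ⟩
    rep N (F (t ℕ.+ 1))          ∎
    where
    cancel : ∀ i j → i + (j - i) ≡ j
    cancel = solve-∀

  -- Between i and its return, the classes met are neither that of i nor that of j, where g̅ acts as f.
  orb≡ : ∀ u → 0 ℕ.< u → u ℕ.≤ b → orb u ≡ rep N (F (t ℕ.+ u))
  orb≡ (suc zero)    _ _     = orb-1
  orb≡ (suc (suc u)) _ 2+u≤b = begin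
    g̅ (orb (suc u))                       ≡⟨ cong g̅ (orb≡ (suc u) (s≤s z≤n) (ℕₚ.<⇒≤ 2+u≤b)) ⟩
    rep N (swapVals N f i j R)            ≡⟨ cong (rep N) (swapVals-elsewhere N f i j R
                                               (F-avoids-i (suc u) 2+u≤b ∘ trans (sym rep-R≡R))
                                               (F-avoids-j (suc u) (s≤s z≤n) 2+u≤b ∘ trans (sym rep-R≡R))) ⟩
    rep N (f R)                           ≡⟨ rep-f-≡ rep-R≡R ⟩
    rep N (F (suc (t ℕ.+ suc u)))         ≡⟨ cong (rep N ∘ F) (ℕₚ.+-suc t (suc u)) ⟨
    rep N (F (t ℕ.+ suc (suc u)))         ∎
    where
    R = rep N (F (t ℕ.+ suc u))
    rep-R≡R : rep N R ≡ R
    rep-R≡R = rep-idem (F (t ℕ.+ suc u))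

  orb-b : orb b ≡ i
  orb-b = orb≡ b 0<b ℕₚ.≤-refl

  orb-no-early-return : ∀ u → 0 ℕ.< u → u ℕ.< b → orb u ≢ i
  orb-no-early-return u 0<u u<b eq =
    F-avoids-i u u<b (trans (sym (orb≡ u 0<u (ℕₚ.<⇒≤ u<b))) (trans eq (sym rep-i)))

  -- A lift of the cycle to ℤ whose steps are those of f, except the first one, from y to f x.
  lifted : ℕ → ℤ
  lifted zero    = y
  lifted (suc u) = F (t ℕ.+ suc u) + A

  rep-lifted : ∀ u → u ℕ.≤ b → rep N (lifted u) ≡ orb u
  rep-lifted zero    _     = refl
  rep-lifted (suc u) 1+u≤b = trans (rep-+* (F (t ℕ.+ suc u)) (+ a)) (sym (orb≡ (suc u) (s≤s z≤n) 1+u≤b))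

  lifted-steps : ∀ u → u ℕ.< b → lifted u < lifted (suc u) × lifted (suc u) < lifted u + + N
  lifted-steps zero    _ = subst (y <_) fx≡lifted-1 (<-trans y<x (lower x))
                         , subst (_< y + + N) fx≡lifted-1 (<-trans fx<fy (upper y))
    where
    fx≡lifted-1 : f x ≡ lifted 1
    fx≡lifted-1 = trans fx≡ (cong (λ v → F v + A) (ℕₚ.+-comm 1 t))
  lifted-steps (suc u) _ = subst (w <_) fw≡ (lower w) , subst (_< w + + N) fw≡ (upper w)
    where
    w = lifted (suc u)
    fw≡ : f w ≡ lifted (suc (suc u))
    fw≡ = trans (f-+* (F (t ℕ.+ suc u)) (+ a)) (cong (λ v → F v + A) (sym (ℕₚ.+-suc t (suc u))))

  descents-orb : descents orb b ≡ a
  descents-orb = sym (+-injective (*-cancelʳ-≡ (+ a) (+ descents orb b) (+ N) (begin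
    A                                        ≡⟨ cancel y A ⟨
    y + A - y                                ≡⟨ cong (_- y) (lifted-pos b 0<b) ⟨
    lifted b - lifted 0                      ≡⟨ lift-descents lifted orb b rep-lifted lifted-steps ⟩
    orb b - orb 0 + + N * + descents orb b   ≡⟨ cong (λ z → z - i + + N * + descents orb b) orb-b ⟩
    i - i + + N * + descents orb b           ≡⟨ cong (_+ + N * + descents orb b) (+-inverseʳ i) ⟩
    0ℤ + + N * + descents orb b              ≡⟨ +-identityˡ _ ⟩
    + N * + descents orb b                   ≡⟨ *-comm (+ N) _ ⟩
    + descents orb b * + N                   ∎)))
    where
    cancel : ∀ y A → y + A - y ≡ A
    cancel = solve-∀
    lifted-pos : ∀ u → 0 ℕ.< u → lifted u ≡ F (t ℕ.+ u) + A
    lifted-pos (suc u) _ = refl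

  inversion : InF' N f a b
  inversion = i , j , rep-lower y , rep-upper y , i<j , fj<fi
            , 0<b , orb-b , orb-no-early-return , sym descents-orb

lemma4p6 : (k n : ℕ) (f : ℤ → ℤ) (θ : IsTheta k n f) (a b : ℕ)
    → 1 ℕ.≤ a → a ℕ.≤ k ℕ.∸ 1 → 1 ℕ.≤ b → b ℕ.≤ n ℕ.∸ 1
    → (slope a b ℚ.≤ slope k n → ∃[ r ] Below θ (qpt θ a b r))
    × (slope k n ℚ.≤ slope a b → ∃[ r ] Above θ (qpt θ a b r))
    × (slope a b ≡ slope k n → InF' n f a b)
lemma4p6 k zero    f θ a b       _ _ _   _   = ⊥-elim (ℕₚ.n≮0 (IsTheta.k<n θ))
lemma4p6 k (suc m) f θ a (suc b) _ _ 0<b b≤m =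
    below-exists 0<b b<N ∘ /≤/⇒*≤* (+ a) (+ k) b m
  , above-exists 0<b b<N ∘ /≤/⇒*≤* (+ k) (+ a) m b
  , λ α∥δ →
      let t , Dt<0 , 0<Dt+1 = sign-change-of-D 0<b b<N
            (≤-antisym (/≤/⇒*≤* (+ a) (+ k) b m (ℚₚ.≤-reflexive α∥δ))
                       (/≤/⇒*≤* (+ k) (+ a) m b (ℚₚ.≤-reflexive (sym α∥δ))))
      in Inversion.inversion θ a (suc b) 0<b b<N t Dt<0 0<Dt+1
  where
  open Chords θ a (suc b)
  b<N : suc b ℕ.< suc m
  b<N = s≤s b≤m
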